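{- Let $h,k$ be integers with $hk(h+k)\neq 0$, and let $n$ be an integer with $n(n+h)(n-k)\neq 0$. Then $$d(n)\,d(n+h)\,d(n-k)\le d(h)\,d(k)\,d(h+k)\,d\big(n(n+h)(n-k)\big).$$
   Context: For a nonzero integer $m$, $d(m)$ denotes the number of positive divisors of $m$ (so $d(m)=d(|m|)$). -}

module Defs where

open import Data.Nat using (ℕ)
open import Data.Nat.Divisibility using (_∣?_)
open import Data.List using (filter; length; applyUpTo)
open import Data.Integer using (ℤ; ∣_∣)
open import Data.Nat using (suc)

-- number of positive divisors of a natural number m:
-- #{ i ∈ {1,…,m} : i ∣ m }   (d 0 = 0, never used below since arguments are nonzero)
dℕ : ℕ → ℕ
dℕ m = length (filter (λ i → i ∣? m) (applyUpTo suc m))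

d : ℤ → ℕ
d m = dℕ ∣ m ∣

-- Put a = |n|, b = |n + h|, c = |n - k|: a common divisor of two of them divides the corresponding
-- one of h, k, h + k. The divisor function satisfies d(xy) ≤ d(x) d(y) and d(x) d(y) ≤ d(gcd(x, y)) d(xy),
-- both by injections between lists of divisors. Using the second twice,
-- d(a) d(b) d(c) ≤ d(gcd(a, b)) d(gcd(ab, c)) d(abc), and gcd(ab, c) divides gcd(a, c) gcd(b, c),
-- whence d(gcd(ab, c)) ≤ d(k) d(h + k) by the first.
{-# OPTIONS --safe #-}
module Submission where

open import Defs

module Counting where
  open import Data.Nat using (_≤_; _*_; _+_)
  open import Data.Fin using (Fin; zero; suc)
  open import Data.Fin.Properties using (injective⇒≤)
  open import Data.List using (List; []; _∷_; length; lookup; cartesianProduct; map)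
  open import Data.List.Properties using (length-++; length-map)
  open import Data.List.Membership.Propositional using (_∈_)
  open import Data.List.Membership.Propositional.Properties using (∈-lookup)
  open import Data.List.Relation.Unary.Any using (index)
  open import Data.List.Relation.Unary.Any.Properties using (lookup-index)
  import Data.List.Relation.Unary.All as All
  open import Data.List.Relation.Unary.AllPairs using (_∷_)
  open import Data.List.Relation.Unary.Unique.Propositional using (Unique)
  open import Data.Product using (_,_)
  open import Function.Definitions using (Injective)
  open import Relation.Binary.PropositionalEquality using (_≡_; refl; sym; trans; cong; cong₂; module ≡-Reasoning)
  open import Relation.Nullary using (contradiction)

  module _ {A : Set} where

    lookup-injective : ∀ {xs : List A} → Unique xs → ∀ i j → lookup xs i ≡ lookup xs j → i ≡ j
    lookup-injective (_ ∷ _)     zero    zero    _  = refl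
    lookup-injective (x∉xs ∷ _)  zero    (suc j) eq = contradiction eq (All.lookup x∉xs (∈-lookup j))
    lookup-injective (x∉xs ∷ _)  (suc i) zero    eq = contradiction (sym eq) (All.lookup x∉xs (∈-lookup i))
    lookup-injective (_ ∷ xs!)   (suc i) (suc j) eq = cong suc (lookup-injective xs! i j eq)

    module _ {B : Set} where

      injectiveOn⇒length≤ : ∀ {xs : List A} {ys : List B} (f : A → B) → Unique xs →
                            (∀ {x} → x ∈ xs → f x ∈ ys) →
                            (∀ {x y} → x ∈ xs → y ∈ xs → f x ≡ f y → x ≡ y) →
                            length xs ≤ length ys
      injectiveOn⇒length≤ {xs} {ys} f xs! f∈ys f-inj = injective⇒≤ position-injective
        where
        position : Fin (length xs) → Fin (length ys)
        position i = index (f∈ys (∈-lookup i))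

        position-injective : Injective _≡_ _≡_ position
        position-injective {i} {j} eq = lookup-injective xs! i j (f-inj (∈-lookup i) (∈-lookup j) (begin
          f (lookup xs i)        ≡⟨ lookup-index (f∈ys (∈-lookup i)) ⟩
          lookup ys (position i) ≡⟨ cong (lookup ys) eq ⟩
          lookup ys (position j) ≡⟨ lookup-index (f∈ys (∈-lookup j)) ⟨
          f (lookup xs j)        ∎))
          where open ≡-Reasoning

      length-cartesianProduct : ∀ (xs : List A) (ys : List B) →
                                length (cartesianProduct xs ys) ≡ length xs * length ys
      length-cartesianProduct []       ys = refl
      length-cartesianProduct (x ∷ xs) ys = trans (length-++ (map (x ,_) ys))
        (cong₂ _+_ (length-map (x ,_) ys) (length-cartesianProduct xs ys))

module DivisorFunction where
  open import Data.Nat using (ℕ; zero; suc; _≤_; _*_; z≤n; s≤s; NonZero; >-nonZero; ≢-nonZero; ≢-nonZero⁻¹)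
  open import Data.Nat.Properties
    using (≤-trans; *-mono-≤; *-monoˡ-≤; *-monoʳ-≤; *-assoc; *-comm; suc-injective; <⇒≢;
           m*n≢0; m*n≢0⇒m≢0; m*n≢0⇒n≢0; *-cancelʳ-≡; module ≤-Reasoning)
  open import Data.Nat.Divisibility
    using (_∣_; _∣?_; ∣-trans; ∣⇒≤; *-pres-∣; *-cancelˡ-∣; *-monoˡ-∣; n∣m*n; divides)
  open import Data.Nat.DivMod using (_/_; m*[n/m]≡n)
  open import Data.Nat.GCD using (gcd; gcd[m,n]≢0; gcd[m,n]∣m; gcd[m,n]∣n; gcd-greatest; c*gcd[m,n]≡gcd[cm,cn])
  open import Data.List using (List; filter; applyUpTo; length; cartesianProduct; map)
  open import Data.List.Properties using (length-map)
  open import Data.List.Membership.Propositional using (_∈_)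
  open import Data.List.Membership.Propositional.Properties
    using (∈-filter⁺; ∈-filter⁻; ∈-applyUpTo⁺; ∈-applyUpTo⁻; ∈-cartesianProduct⁺; ∈-cartesianProduct⁻;
           ∈-map⁺)
  open import Data.List.Relation.Unary.Unique.Propositional using (Unique)
  import Data.List.Relation.Unary.Unique.Propositional.Properties as Unique
  open import Data.Product using (_×_; _,_; proj₁; proj₂; uncurry)
  open import Data.Sum using (inj₁)
  open import Function using (id; _∘_)
  open import Relation.Binary.PropositionalEquality using (_≡_; refl; sym; trans; cong; cong₂; subst; module ≡-Reasoning)
  open import Relation.Nullary using (contradiction)
  open Counting

  divisors : ℕ → List ℕ
  divisors m = filter (_∣? m) (applyUpTo suc m)

  divisors-unique : ∀ m → Unique (divisors m)
  divisors-unique m = Unique.filter⁺ (_∣? m) (Unique.applyUpTo⁺₁ suc m (λ i<j _ → <⇒≢ i<j ∘ suc-injective))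

  ∈-divisors⁺ : ∀ {m x} .{{_ : NonZero m}} .{{_ : NonZero x}} → x ∣ m → x ∈ divisors m
  ∈-divisors⁺ {m} {zero}  _   = contradiction refl (≢-nonZero⁻¹ 0)
  ∈-divisors⁺ {m} {suc i} x∣m = ∈-filter⁺ (_∣? m) (∈-applyUpTo⁺ suc (∣⇒≤ x∣m)) x∣m

  ∈-divisors⁻ : ∀ {m x} → x ∈ divisors m → NonZero m × NonZero x × x ∣ m
  ∈-divisors⁻ {m} x∈ with ∈-filter⁻ (_∣? m) {xs = applyUpTo suc m} x∈
  ... | x∈range , x∣m with ∈-applyUpTo⁻ suc x∈range
  ... | i , i<m , refl = >-nonZero (≤-trans (s≤s z≤n) i<m) , _ , x∣m

  gcd≢0ˡ : ∀ m n .{{_ : NonZero m}} → NonZero (gcd m n)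
  gcd≢0ˡ m n = ≢-nonZero (gcd[m,n]≢0 m n (inj₁ (≢-nonZero⁻¹ m)))

  m∣n*o⇒m∣gcd[m,n]*o : ∀ {m n o} → m ∣ n * o → m ∣ gcd m n * o
  m∣n*o⇒m∣gcd[m,n]*o {m} {n} {o} m∣n*o = subst (m ∣_) gcd[om,on]≡gcd[m,n]*o
    (gcd-greatest (n∣m*n o) (subst (m ∣_) (*-comm n o) m∣n*o))
    where
    gcd[om,on]≡gcd[m,n]*o : gcd (o * m) (o * n) ≡ gcd m n * o
    gcd[om,on]≡gcd[m,n]*o = trans (sym (c*gcd[m,n]≡gcd[cm,cn] o m n)) (*-comm o (gcd m n))

  gcd[m*n,o]∣gcd[m,o]*gcd[n,o] : ∀ m n o → gcd (m * n) o ∣ gcd m o * gcd n o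
  gcd[m*n,o]∣gcd[m,o]*gcd[n,o] m n o = subst (g ∣_) (sym (c*gcd[m,n]≡gcd[cm,cn] (gcd m o) n o))
    (gcd-greatest g∣gcd[m,o]*n (∣-trans g∣o (n∣m*n (gcd m o))))
    where
    g : ℕ
    g = gcd (m * n) o
    g∣o : g ∣ o
    g∣o = gcd[m,n]∣n (m * n) o
    gcd[g,m]∣gcd[m,o] : gcd g m ∣ gcd m o
    gcd[g,m]∣gcd[m,o] = gcd-greatest (gcd[m,n]∣n g m) (∣-trans (gcd[m,n]∣m g m) g∣o)
    g∣gcd[m,o]*n : g ∣ gcd m o * n
    g∣gcd[m,o]*n = ∣-trans (m∣n*o⇒m∣gcd[m,n]*o (gcd[m,n]∣m (m * n) o)) (*-monoˡ-∣ n gcd[g,m]∣gcd[m,o])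

  gcd[m*n,o]≡n*gcd[m,o/n] : ∀ m {n o} .{{_ : NonZero n}} → n ∣ o → gcd (m * n) o ≡ n * gcd m (o / n)
  gcd[m*n,o]≡n*gcd[m,o/n] m {n} {o} n∣o = begin
    gcd (m * n) o             ≡⟨ cong₂ gcd (*-comm m n) (sym (m*[n/m]≡n n∣o)) ⟩
    gcd (n * m) (n * (o / n)) ≡⟨ c*gcd[m,n]≡gcd[cm,cn] n m (o / n) ⟨
    n * gcd m (o / n)         ∎
    where open ≡-Reasoning

  dℕ-mono-∣ : ∀ {m n} .{{_ : NonZero n}} → m ∣ n → dℕ m ≤ dℕ n
  dℕ-mono-∣ {m} {n} {{n≢0}} m∣n = injectiveOn⇒length≤ id (divisors-unique m) divisor-of-n (λ _ _ → id)
    where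
    divisor-of-n : ∀ {x} → x ∈ divisors m → x ∈ divisors n
    divisor-of-n x∈ with _ , x≢0 , x∣m ← ∈-divisors⁻ x∈ = ∈-divisors⁺ {{n≢0}} {{x≢0}} (∣-trans x∣m m∣n)

  dℕ[m*n]≤dℕ[m]*dℕ[n] : ∀ m n → dℕ (m * n) ≤ dℕ m * dℕ n
  dℕ[m*n]≤dℕ[m]*dℕ[n] m n = begin
    dℕ (m * n)                        ≤⟨ injectiveOn⇒length≤ id (divisors-unique (m * n)) split (λ _ _ → id) ⟩
    length (map (uncurry _*_) pairs)  ≡⟨ length-map (uncurry _*_) pairs ⟩
    length pairs                      ≡⟨ length-cartesianProduct (divisors m) (divisors n) ⟩
    dℕ m * dℕ n                       ∎
    where
    open ≤-Reasoning
    pairs : List (ℕ × ℕ)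
    pairs = cartesianProduct (divisors m) (divisors n)

    split : ∀ {x} → x ∈ divisors (m * n) → x ∈ map (uncurry _*_) pairs
    split {x} x∈ with mn≢0 , x≢0 , x∣mn ← ∈-divisors⁻ x∈ =
      subst (_∈ map (uncurry _*_) pairs) g*q≡x
        (∈-map⁺ (uncurry _*_) (∈-cartesianProduct⁺ (∈-divisors⁺ {{m≢0}} {{g≢0}} (gcd[m,n]∣n x m))
                                                    (∈-divisors⁺ {{n≢0}} {{q≢0}} q∣n)))
      where
      m≢0 : NonZero m
      m≢0 = m*n≢0⇒m≢0 m {{mn≢0}}
      n≢0 : NonZero n
      n≢0 = m*n≢0⇒n≢0 m {{mn≢0}}
      g q : ℕ
      g = gcd x m
      instance
        g≢0 : NonZero g
        g≢0 = gcd≢0ˡ x m {{x≢0}}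
      q = x / g
      g*q≡x : g * q ≡ x
      g*q≡x = m*[n/m]≡n (gcd[m,n]∣m x m)
      q≢0 : NonZero q
      q≢0 = m*n≢0⇒n≢0 g {{subst NonZero (sym g*q≡x) x≢0}}
      q∣n : q ∣ n
      q∣n = *-cancelˡ-∣ g (subst (_∣ g * n) (sym g*q≡x) (m∣n*o⇒m∣gcd[m,n]*o x∣mn))

  dℕ[m]*dℕ[n]≤dℕ[gcd[m,n]]*dℕ[m*n] : ∀ m n → dℕ m * dℕ n ≤ dℕ (gcd m n) * dℕ (m * n)
  dℕ[m]*dℕ[n]≤dℕ[gcd[m,n]]*dℕ[m*n] m n = begin
    dℕ m * dℕ n                ≡⟨ length-cartesianProduct (divisors m) (divisors n) ⟨
    length pairs               ≤⟨ injectiveOn⇒length≤ encode pairs-unique encode∈ encode-injective ⟩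
    length targets             ≡⟨ length-cartesianProduct (divisors (gcd m n)) (divisors (m * n)) ⟩
    dℕ (gcd m n) * dℕ (m * n)  ∎
    where
    open ≤-Reasoning
    pairs targets : List (ℕ × ℕ)
    pairs   = cartesianProduct (divisors m) (divisors n)
    targets = cartesianProduct (divisors (gcd m n)) (divisors (m * n))

    pairs-unique : Unique pairs
    pairs-unique = Unique.cartesianProduct⁺ (divisors-unique m) (divisors-unique n)

    -- Injective on divisor pairs because gcd (x * y) n = y * gcd x (n / y) recovers y.
    -- The clause for y = 0 is junk: 0 is never a divisor.
    encode : ℕ × ℕ → ℕ × ℕ
    encode (x , zero)      = x , zero
    encode (x , y@(suc _)) = gcd x (n / y) , x * y

    encode-nonZero : ∀ x y .{{_ : NonZero y}} → encode (x , y) ≡ (gcd x (n / y) , x * y)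
    encode-nonZero x zero    = contradiction refl (≢-nonZero⁻¹ 0)
    encode-nonZero x (suc _) = refl

    n/y∣n : ∀ {y} .{{_ : NonZero y}} → y ∣ n → n / y ∣ n
    n/y∣n {y} y∣n = divides y (sym (m*[n/m]≡n y∣n))

    encode-divisors : ∀ {x y} .{{_ : NonZero m}} .{{_ : NonZero n}} .{{_ : NonZero x}} .{{_ : NonZero y}} →
                      x ∣ m → y ∣ n → encode (x , y) ∈ targets
    encode-divisors {x} {y} x∣m y∣n = subst (_∈ targets) (sym (encode-nonZero x y))
      (∈-cartesianProduct⁺
        (∈-divisors⁺ {{gcd≢0ˡ m n}} {{gcd≢0ˡ x (n / y)}}
          (gcd-greatest (∣-trans (gcd[m,n]∣m x (n / y)) x∣m) (∣-trans (gcd[m,n]∣n x (n / y)) (n/y∣n y∣n))))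
        (∈-divisors⁺ {{m*n≢0 m n}} {{m*n≢0 x y}} (*-pres-∣ x∣m y∣n)))

    encode∈ : ∀ {p} → p ∈ pairs → encode p ∈ targets
    encode∈ p∈ with x∈ , y∈ ← ∈-cartesianProduct⁻ (divisors m) (divisors n) p∈
               with m≢0 , x≢0 , x∣m ← ∈-divisors⁻ x∈
               with n≢0 , y≢0 , y∣n ← ∈-divisors⁻ y∈ =
      encode-divisors {{m≢0}} {{n≢0}} {{x≢0}} {{y≢0}} x∣m y∣n

    encode-injective-divisors : ∀ {x y x′ y′} .{{_ : NonZero x}} .{{_ : NonZero y}} .{{_ : NonZero y′}} →
                                y ∣ n → y′ ∣ n → encode (x , y) ≡ encode (x′ , y′) → (x , y) ≡ (x′ , y′)
    encode-injective-divisors {x} {y} {x′} {y′} y∣n y′∣n eq = cong₂ _,_ x≡x′ y≡y′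
      where
      eq′ : (gcd x (n / y) , x * y) ≡ (gcd x′ (n / y′) , x′ * y′)
      eq′ = trans (sym (encode-nonZero x y)) (trans eq (encode-nonZero x′ y′))
      y≡y′ : y ≡ y′
      y≡y′ = *-cancelʳ-≡ y y′ (gcd x (n / y)) {{gcd≢0ˡ x (n / y)}} (begin-equality
        y * gcd x (n / y)    ≡⟨ gcd[m*n,o]≡n*gcd[m,o/n] x y∣n ⟨
        gcd (x * y) n        ≡⟨ cong (λ z → gcd z n) (cong proj₂ eq′) ⟩
        gcd (x′ * y′) n      ≡⟨ gcd[m*n,o]≡n*gcd[m,o/n] x′ y′∣n ⟩
        y′ * gcd x′ (n / y′) ≡⟨ cong (y′ *_) (cong proj₁ eq′) ⟨
        y′ * gcd x (n / y)   ∎)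
      x≡x′ : x ≡ x′
      x≡x′ = *-cancelʳ-≡ x x′ y (trans (cong proj₂ eq′) (cong (x′ *_) (sym y≡y′)))

    encode-injective : ∀ {p q} → p ∈ pairs → q ∈ pairs → encode p ≡ encode q → p ≡ q
    encode-injective p∈ q∈ with x∈ , y∈ ← ∈-cartesianProduct⁻ (divisors m) (divisors n) p∈
                           with _ , y′∈ ← ∈-cartesianProduct⁻ (divisors m) (divisors n) q∈
                           with _ , x≢0 , _ ← ∈-divisors⁻ {m} x∈
                           with _ , y≢0 , y∣n ← ∈-divisors⁻ y∈
                           with _ , y′≢0 , y′∣n ← ∈-divisors⁻ y′∈ =
      encode-injective-divisors {{x≢0}} {{y≢0}} {{y′≢0}} y∣n y′∣n

  dℕ-triple-bound : ∀ a b c {h k l} .{{_ : NonZero h}} .{{_ : NonZero k}} .{{_ : NonZero l}} →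
                    gcd a b ∣ h → gcd a c ∣ k → gcd b c ∣ l →
                    dℕ a * dℕ b * dℕ c ≤ dℕ h * dℕ k * dℕ l * dℕ (a * b * c)
  dℕ-triple-bound a b c {h} {k} {l} gcd[a,b]∣h gcd[a,c]∣k gcd[b,c]∣l = begin
    dℕ a * dℕ b * dℕ c                              ≤⟨ *-monoˡ-≤ (dℕ c) (dℕ[m]*dℕ[n]≤dℕ[gcd[m,n]]*dℕ[m*n] a b) ⟩
    dℕ (gcd a b) * dℕ (a * b) * dℕ c                ≡⟨ *-assoc (dℕ (gcd a b)) (dℕ (a * b)) (dℕ c) ⟩
    dℕ (gcd a b) * (dℕ (a * b) * dℕ c)              ≤⟨ *-mono-≤ (dℕ-mono-∣ gcd[a,b]∣h) (dℕ[m]*dℕ[n]≤dℕ[gcd[m,n]]*dℕ[m*n] (a * b) c) ⟩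
    dℕ h * (dℕ (gcd (a * b) c) * dℕ (a * b * c))    ≤⟨ *-monoʳ-≤ (dℕ h) (*-monoˡ-≤ (dℕ (a * b * c)) dℕ[gcd[a*b,c]]≤dℕ[k]*dℕ[l]) ⟩
    dℕ h * (dℕ k * dℕ l * dℕ (a * b * c))           ≡⟨ *-assoc (dℕ h) (dℕ k * dℕ l) (dℕ (a * b * c)) ⟨
    dℕ h * (dℕ k * dℕ l) * dℕ (a * b * c)           ≡⟨ cong (_* dℕ (a * b * c)) (*-assoc (dℕ h) (dℕ k) (dℕ l)) ⟨
    dℕ h * dℕ k * dℕ l * dℕ (a * b * c)             ∎
    where
    open ≤-Reasoning
    dℕ[gcd[a*b,c]]≤dℕ[k]*dℕ[l] : dℕ (gcd (a * b) c) ≤ dℕ k * dℕ l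
    dℕ[gcd[a*b,c]]≤dℕ[k]*dℕ[l] = ≤-trans
      (dℕ-mono-∣ {{m*n≢0 k l}} (∣-trans (gcd[m*n,o]∣gcd[m,o]*gcd[n,o] a b c) (*-pres-∣ gcd[a,c]∣k gcd[b,c]∣l)))
      (dℕ[m*n]≤dℕ[m]*dℕ[n] k l)

open import Data.Nat using (_≤_) renaming (_*_ to _*ℕ_)
open import Data.Integer using (ℤ; _+_; _-_; _*_; 0ℤ)
open import Relation.Binary.PropositionalEquality using (_≢_)

open import Data.Nat using (NonZero)
open import Data.Nat.Divisibility using () renaming (_∣_ to _∣ℕ_)
open import Data.Nat.GCD using (gcd; gcd[m,n]∣m; gcd[m,n]∣n)
open import Data.Nat.Properties using (m*n≢0⇒m≢0; m*n≢0⇒n≢0)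
open import Data.Integer using (∣_∣; +_)
import Data.Integer.Base as ℤ using (≢-nonZero)
open import Data.Integer.Properties using (abs-*; ∣i-j∣≡∣j-i∣)
open import Data.Integer.Divisibility.Signed using (∣ᵤ⇒∣; ∣⇒∣ᵤ; ∣m∣n⇒∣m-n)
open import Data.Integer.Tactic.RingSolver using (solve-∀)
open import Data.Product using (_×_; _,_)
open import Relation.Binary.PropositionalEquality using (_≡_; trans; sym; cong; subst)
open DivisorFunction using (dℕ-triple-bound)

∣i*j*k∣≡∣i∣*∣j∣*∣k∣ : ∀ i j k → ∣ i * j * k ∣ ≡ ∣ i ∣ *ℕ ∣ j ∣ *ℕ ∣ k ∣
∣i*j*k∣≡∣i∣*∣j∣*∣k∣ i j k = trans (abs-* (i * j) k) (cong (_*ℕ ∣ k ∣) (abs-* i j))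

i*j*k≢0⇒∣i∣,∣j∣,∣k∣≢0 : ∀ i j k → i * j * k ≢ 0ℤ → NonZero ∣ i ∣ × NonZero ∣ j ∣ × NonZero ∣ k ∣
i*j*k≢0⇒∣i∣,∣j∣,∣k∣≢0 i j k ijk≢0 =
  m*n≢0⇒m≢0 (∣ i ∣) {{ij≢0}} , m*n≢0⇒n≢0 (∣ i ∣) {{ij≢0}} , m*n≢0⇒n≢0 (∣ i ∣ *ℕ ∣ j ∣) {{ijk≢0′}}
  where
  ijk≢0′ : NonZero (∣ i ∣ *ℕ ∣ j ∣ *ℕ ∣ k ∣)
  ijk≢0′ = subst NonZero (∣i*j*k∣≡∣i∣*∣j∣*∣k∣ i j k) (ℤ.≢-nonZero ijk≢0)
  ij≢0 : NonZero (∣ i ∣ *ℕ ∣ j ∣)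
  ij≢0 = m*n≢0⇒m≢0 (∣ i ∣ *ℕ ∣ j ∣) {{ijk≢0′}}

gcd[∣i∣,∣j∣]∣∣i-j∣ : ∀ i j → gcd ∣ i ∣ ∣ j ∣ ∣ℕ ∣ i - j ∣
gcd[∣i∣,∣j∣]∣∣i-j∣ i j =
  ∣⇒∣ᵤ (∣m∣n⇒∣m-n {+ g} {i} {j} (∣ᵤ⇒∣ {+ g} {i} (gcd[m,n]∣m ∣ i ∣ ∣ j ∣)) (∣ᵤ⇒∣ {+ g} {j} (gcd[m,n]∣n ∣ i ∣ ∣ j ∣)))
  where g = gcd ∣ i ∣ ∣ j ∣

lemma2p5 : (h k n : ℤ) → h * k * (h + k) ≢ 0ℤ → n * (n + h) * (n - k) ≢ 0ℤ →
    d n *ℕ d (n + h) *ℕ d (n - k) ≤ d h *ℕ d k *ℕ d (h + k) *ℕ d (n * (n + h) * (n - k))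
lemma2p5 h k n hk[h+k]≢0 _ with h≢0 , k≢0 , h+k≢0 ← i*j*k≢0⇒∣i∣,∣j∣,∣k∣≢0 h k (h + k) hk[h+k]≢0 =
  subst (λ m → d n *ℕ d (n + h) *ℕ d (n - k) ≤ d h *ℕ d k *ℕ d (h + k) *ℕ dℕ m)
    (sym (∣i*j*k∣≡∣i∣*∣j∣*∣k∣ n (n + h) (n - k)))
    (dℕ-triple-bound (∣ n ∣) (∣ n + h ∣) (∣ n - k ∣) {{h≢0}} {{k≢0}} {{h+k≢0}} gcd∣h gcd∣k gcd∣h+k)
  where
  [a+b]-a≡b : ∀ a b → (a + b) - a ≡ b
  [a+b]-a≡b = solve-∀
  a-[a-b]≡b : ∀ a b → a - (a - b) ≡ b
  a-[a-b]≡b = solve-∀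
  [a+b]-[a-c]≡b+c : ∀ a b c → (a + b) - (a - c) ≡ b + c
  [a+b]-[a-c]≡b+c = solve-∀

  gcd∣h : gcd (∣ n ∣) (∣ n + h ∣) ∣ℕ ∣ h ∣
  gcd∣h = subst (gcd (∣ n ∣) (∣ n + h ∣) ∣ℕ_) (trans (∣i-j∣≡∣j-i∣ n (n + h)) (cong ∣_∣ ([a+b]-a≡b n h)))
    (gcd[∣i∣,∣j∣]∣∣i-j∣ n (n + h))
  gcd∣k : gcd (∣ n ∣) (∣ n - k ∣) ∣ℕ ∣ k ∣
  gcd∣k = subst (gcd (∣ n ∣) (∣ n - k ∣) ∣ℕ_) (cong ∣_∣ (a-[a-b]≡b n k)) (gcd[∣i∣,∣j∣]∣∣i-j∣ n (n - k))
  gcd∣h+k : gcd (∣ n + h ∣) (∣ n - k ∣) ∣ℕ ∣ h + k ∣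
  gcd∣h+k = subst (gcd (∣ n + h ∣) (∣ n - k ∣) ∣ℕ_) (cong ∣_∣ ([a+b]-[a-c]≡b+c n h k))
    (gcd[∣i∣,∣j∣]∣∣i-j∣ (n + h) (n - k))
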